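{- Let $t\in\Lambda^{001}$ and let $P\rhd C\vdash t:T$ be a finite derivation. Then $t$ is head normalizable, i.e. $t$ reduces in finitely many $\beta$-steps to a term of the form $\lambda x_1\ldots x_p.(x\,t_1)\ldots t_q$ with $p,q\ge0$ and $x$ a variable.
   Context: Sequences: $\mathbb{N}^*$ finite sequences of naturals, $\varepsilon$ empty, $\cdot$ concatenation. Terms: $\Lambda^{111}$ = possibly infinite $\lambda$-terms $t,u::=x\mid\lambda x.t\mid tu$ (coinductive, up to $\alpha$-equivalence), identified with parsing trees: $\mathrm{supp}(x)=\{\varepsilon\}$, $\mathrm{supp}(\lambda x.t)=\{\varepsilon\}\cup0\cdot\mathrm{supp}(t)$, $\mathrm{supp}(tu)=\{\varepsilon\}\cup1\cdot\mathrm{supp}(t)\cup2\cdot\mathrm{supp}(u)$. $\Lambda^{001}$: terms every infinite branch of whose support has infinitely many entries $2$. A $\beta$-step replaces a subterm $(\lambda x.r)s$ by $r[s/x]$. Types: mutually coinductive $T::=\alpha\mid F\to T$, $F::=(T_k)_{k\in K}$, $K\subseteq\mathbb{N}\setminus\{0,1\}$, syntactic equality; $\mathrm{supp}(\alpha)=\{\varepsilon\}$, $\mathrm{supp}(F\to T)=\{\varepsilon\}\cup\mathrm{supp}(F)\cup1\cdot\mathrm{supp}(T)$, $\mathrm{supp}((T_k)_k)=\bigcup_kk\cdot\mathrm{supp}(T_k)$; supports have no infinite branch ending in $1^\omega$. $()$ empty sequence type; $k\cdot T$ single component $T$ at index $k$; sequence types with disjoint index sets are disjoint and their join collects all components. Contexts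 map variables to sequence types; $C-x$ resets $x$ to $()$; joins pointwise. Derivations: possibly infinite trees of judgments $C\vdash t:T$ generated coinductively by (ax) $x:k\cdot T\vdash x:T$, $k\ge2$; (abs) from $C\vdash t:T$ infer $C-x\vdash\lambda x.t:C(x)\to T$; (app) from $C\vdash t:(S_k)_{k\in K}\to T$ and for each $k\in K$ a premise $D_k\vdash u:S_k$, infer $C\cup\bigcup_kD_k\vdash tu:T$, with $C$ and the $D_k$ pairwise disjoint. Support: $\{\varepsilon\}$ for an axiom, $\{\varepsilon\}\cup0\cdot\mathrm{supp}(P_0)$ for (abs), $\{\varepsilon\}\cup1\cdot\mathrm{supp}(P_1)\cup\bigcup_kk\cdot\mathrm{supp}(P_k)$ for (app); judgment at $a$ is $C(a)\vdash t|_{\overline a}:T(a)$. Bipositions: $(a,c)$ with $c\in\mathrm{supp}(T(a))$ and $(a,x,c)$ with $c\in\mathrm{supp}(C(a)(x))$. $P$ is finite if its set of bipositions is finite. -}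

module Defs where

open import Data.Nat using (ℕ; zero; suc; _+_; _∸_; _≤_; _<ᵇ_; _≡ᵇ_)
open import Data.Bool using (Bool; true; false; if_then_else_)
open import Data.List using (List; []; _∷_; _++_; applyUpTo)
open import Data.Maybe using (Maybe; just; nothing)
open import Data.Product using (Σ; ∃; _×_; _,_)
open import Data.Sum using (_⊎_)
open import Relation.Binary.PropositionalEquality using (_≡_; _≢_)
open import Relation.Binary.Construct.Closure.ReflexiveTransitive using (Star)

-- Possibly infinite λ-terms (Λ¹¹¹) as parsing trees.
-- Variables are de Bruijn indices (= terms up to α-equivalence).
-- Directions: 0 = body of λ, 1 = function of an application, 2 = argument.

data Label : Set where
  varL : ℕ → Label
  lamL : Label
  appL : Label

Tree : Set
Tree = List ℕ → Maybe Label

Defined : {A : Set} → Maybe A → Set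
Defined {A} m = Σ A λ a → m ≡ just a

child : ℕ → Tree → Tree
child i t p = t (i ∷ p)

subtree : List ℕ → Tree → Tree
subtree p t q = t (p ++ q)

LocalWF : Tree → Set
LocalWF u with u []
... | nothing     = ∀ i → u (i ∷ []) ≡ nothing
... | just (varL x) = ∀ i → u (i ∷ []) ≡ nothing
... | just lamL   = Defined (u (0 ∷ [])) × (∀ i → i ≢ 0 → u (i ∷ []) ≡ nothing)
... | just appL   = Defined (u (1 ∷ [])) × Defined (u (2 ∷ [])) ×
                    (∀ i → i ≢ 1 → i ≢ 2 → u (i ∷ []) ≡ nothing)

IsTerm : Tree → Set
IsTerm t = Defined (t []) × (∀ p → LocalWF (subtree p t))

record Term : Set where
  constructor mkTerm
  field
    tree   : Tree
    isTerm : IsTerm tree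

open Term public

Λ001 : Tree → Set
Λ001 t = (b : ℕ → ℕ) → (∀ n → Defined (t (applyUpTo b n))) →
         ∀ n → Σ ℕ λ m → n ≤ m × b m ≡ 2

-- label at position q of  s  with free variables shifted by d,
-- e = number of λ's of s passed so far
shiftLab : ℕ → ℕ → Tree → List ℕ → Maybe Label
shiftLab d e s [] with s []
... | just (varL m) = just (varL (if m <ᵇ e then m else m + d))
... | other         = other
shiftLab d e s (i ∷ q) with s []
... | just lamL = shiftLab d (if i ≡ᵇ 0 then suc e else e) (child i s) q
... | _         = shiftLab d e (child i s) q

-- label at position q of  r[s/d]  where d = number of λ's of r passed
-- (start with d = 0:  r[s/0] for the body r of  λ.r)
substLab : ℕ → Tree → Tree → List ℕ → Maybe Label
substLab d r s q with r []
substLab d r s q | just (varL n) with n ≡ᵇ d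
... | true  = shiftLab d 0 s q
... | false with q
...   | []     = just (varL (if n <ᵇ d then n else n ∸ 1))
...   | _ ∷ _  = nothing
substLab d r s [] | other = other
substLab d r s (i ∷ q) | just lamL = substLab (if i ≡ᵇ 0 then suc d else d) (child i r) s q
substLab d r s (i ∷ q) | _ = substLab d (child i r) s q

record BetaAt (p : List ℕ) (t t′ : Tree) : Set where
  field
    redexApp : t p ≡ just appL
    redexLam : t (p ++ (1 ∷ [])) ≡ just lamL
    inside   : ∀ q → t′ (p ++ q) ≡
                 substLab 0 (subtree (p ++ (1 ∷ 0 ∷ [])) t) (subtree (p ++ (2 ∷ [])) t) q
    outside  : ∀ q → (∀ q′ → q ≢ p ++ q′) → t′ q ≡ t q

_⟶β_ : Term → Term → Set
t ⟶β t′ = Σ (List ℕ) λ p → BetaAt p (tree t) (tree t′)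

_⟶β*_ : Term → Term → Set
_⟶β*_ = Star _⟶β_

data IsNeutral (t : Tree) : Set where
  nvar : ∀ {x} → t [] ≡ just (varL x) → IsNeutral t
  napp : t [] ≡ just appL → IsNeutral (child 1 t) → IsNeutral t

data IsHNF (t : Tree) : Set where
  hlam : t [] ≡ just lamL → IsHNF (child 0 t) → IsHNF t
  hneu : IsNeutral t → IsHNF t

HeadNormalizable : Term → Set
HeadNormalizable t = Σ Term λ t′ → (t ⟶β* t′) × IsHNF (tree t′)

-- Finite types.  A sequence type (T_k)_{k∈K} with finite K ⊆ ℕ∖{0,1}
-- is a list F of optional components: the i-th entry (0-based) is the
-- component at track k = i + 2 (nothing means k ∉ K).

data Ty : Set where
  atom : ℕ → Ty
  _⇒_  : List (Maybe Ty) → Ty → Ty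

at : List (Maybe Ty) → ℕ → Maybe Ty
at F zero = nothing
at F (suc zero) = nothing
at [] (suc (suc i)) = nothing
at (m ∷ F) (suc (suc zero)) = m
at (m ∷ F) (suc (suc (suc i))) = at F (suc (suc i))

-- contexts: Γ x k = component at track k of the sequence type of variable x
Ctx : Set
Ctx = ℕ → ℕ → Maybe Ty

record DisjUnion (E C : Ctx) (K : ℕ → Set) (D : ℕ → Ctx) : Set where
  field
    fromC   : ∀ x j T → C x j ≡ just T → E x j ≡ just T
    fromD   : ∀ k → K k → ∀ x j T → D k x j ≡ just T → E x j ≡ just T
    toSrc   : ∀ x j T → E x j ≡ just T →
              C x j ≡ just T ⊎ Σ ℕ λ k → K k × D k x j ≡ just T
    disjCD  : ∀ k → K k → ∀ x j → Defined (C x j) → D k x j ≡ nothing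
    disjDD  : ∀ k k′ → K k → K k′ → ∀ x j →
              Defined (D k x j) → Defined (D k′ x j) → k ≡ k′

-- Finite derivations P ▷ C ⊢ t : T  (an inductive, hence finite, tree of
-- rule instances whose types are finite).  With de Bruijn indices, (abs)
-- binds variable 0 and C - x corresponds to dropping/shifting variable 0.
data Deriv : Ctx → Tree → Ty → Set where
  ax  : ∀ {C t T x k} → t [] ≡ just (varL x) → 2 ≤ k →
        C x k ≡ just T →
        (∀ y j → Defined (C y j) → y ≡ x × j ≡ k) →
        Deriv C t T
  abs : ∀ {E C t T F} → t [] ≡ just lamL →
        Deriv C (child 0 t) T →
        (∀ k → at F k ≡ C zero k) →
        (∀ y j → E y j ≡ C (suc y) j) →
        Deriv E t (F ⇒ T)
  app : ∀ {E C t F T} (D : ℕ → Ctx) → t [] ≡ just appL →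
        Deriv C (child 1 t) (F ⇒ T) →
        (∀ k S → at F k ≡ just S → Deriv (D k) (child 2 t) S) →
        DisjUnion E C (λ k → Defined (at F k)) D →
        Deriv E t T

module Submission where

-- Forgetting the tracks of the sequence types turns P into a derivation of a non-idempotent
-- intersection type system with list types and with contexts that are lists of (variable, type)
-- pairs read up to permutation.  A typed term is either a head normal form or has a typed head
-- redex (λx.r)s, and substituting the derivations typing s for the axioms typing x in r types the
-- reduct.  Every argument derivation is used exactly once and the abs and app rules of the redex
-- disappear, so the reduct has a strictly smaller derivation and head reduction stops after at
-- most |P| steps.

open import Defs
open import Data.Nat using (ℕ; zero; suc; _+_; _∸_; _<_; _≟_; _≡ᵇ_; _<ᵇ_; s≤s; z≤n)
open import Data.Nat.Properties
  using (+-suc; +-identityʳ; +-assoc; suc-injective; m≢1+m+n; 0≢1+n; ≤-refl; ≤-trans; ≤-reflexive;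
         +-mono-≤; +-monoˡ-≤; n≤1+n; m≤m+n; +-commutativeSemigroup)
open import Data.Nat.Induction using (<-rec)
open import Data.Bool using (Bool; true; false; if_then_else_)
open import Data.Empty using (⊥)
open import Data.List using (List; []; _∷_; _++_; map; concat; concatMap)
open import Data.List.Properties using (∷-injectiveʳ; ++-identityʳ; concatMap-++; map-++; concat-map; concat-++)
open import Data.Maybe using (Maybe; just; nothing; is-just)
open import Data.Product using (Σ; _×_; _,_; proj₁; proj₂; map₂)
open import Data.Sum using (_⊎_; inj₁; inj₂)
open import Function using (_∘_)
open import Function.Bundles using (mk⇔)
open import Data.List.Membership.Propositional using (_∈_; _∉_)
open import Data.List.Membership.Propositional.Properties using (∈-++⁺ˡ; ∈-++⁺ʳ; ∈-++⁻)
open import Data.List.Membership.Propositional.Properties.WithK using (unique∧set⇒bag)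
open import Data.List.Relation.Binary.BagAndSetEquality using (∼bag⇒↭)
open import Data.List.Relation.Unary.Any using (here; there)
open import Data.List.Relation.Unary.All.Properties.Core using (¬Any⇒All¬)
open import Data.List.Relation.Unary.AllPairs using ([]; _∷_)
open import Data.List.Relation.Unary.Unique.Propositional using (Unique)
import Data.List.Relation.Unary.Unique.Propositional.Properties as Unique
open import Data.List.Relation.Binary.Permutation.Propositional as ↭
  using (_↭_; ↭-refl; ↭-sym; ↭-trans; ↭-reflexive; prep; swap; module PermutationReasoning)
import Data.List.Relation.Binary.Permutation.Propositional.Properties as ↭ₚ
open import Algebra.Bundles using (CommutativeMonoid)
import Algebra.Properties.CommutativeSemigroup as CommutativeSemigroupProperties
open import Relation.Binary.Construct.Closure.ReflexiveTransitive using (ε; _◅_)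
open import Relation.Nullary using (¬_; yes; no; contradiction)
open import Relation.Binary.PropositionalEquality

module +ₚ = CommutativeSemigroupProperties +-commutativeSemigroup

data Kind : Set where
  absent var lam app : Kind

kind : Maybe Label → Kind
kind nothing         = absent
kind (just (varL _)) = var
kind (just lamL)     = lam
kind (just appL)     = app

present : Kind → Bool
present absent = false
present _      = true

-- LocalWF for an arbitrary root label and children, so that it can be transported along equalities.
ChildrenOf : Kind → (ℕ → Maybe Label) → Set
ChildrenOf absent c = ∀ i → c i ≡ nothing
ChildrenOf var    c = ∀ i → c i ≡ nothing
ChildrenOf lam    c = Defined (c 0) × (∀ i → i ≢ 0 → c i ≡ nothing)
ChildrenOf app    c = Defined (c 1) × Defined (c 2) × (∀ i → i ≢ 1 → i ≢ 2 → c i ≡ nothing)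

WellFormedAt : Tree → List ℕ → Set
WellFormedAt u p = ChildrenOf (kind (u p)) (λ i → u (p ++ i ∷ []))

WellFormed : Tree → Set
WellFormed u = ∀ p → WellFormedAt u p

shapeAt : ∀ {v : Tree} → WellFormed v → ∀ p {m} → v p ≡ m → ChildrenOf (kind m) (λ i → v (p ++ i ∷ []))
shapeAt {v} w p vp≡m = subst (λ m → ChildrenOf (kind m) (λ i → v (p ++ i ∷ []))) vp≡m (w p)

shape⇒WellFormedAt : ∀ (v : Tree) p {m} → v p ≡ m → ChildrenOf (kind m) (λ i → v (p ++ i ∷ [])) → WellFormedAt v p
shape⇒WellFormedAt v p vp≡m = subst (λ m → ChildrenOf (kind m) (λ i → v (p ++ i ∷ []))) (sym vp≡m)

LocalWF⇒ChildrenOf : ∀ u → LocalWF u → ChildrenOf (kind (u [])) (λ i → u (i ∷ []))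
LocalWF⇒ChildrenOf u w with u []
... | nothing       = w
... | just (varL _) = w
... | just lamL     = w
... | just appL     = w

ChildrenOf⇒LocalWF : ∀ u → ChildrenOf (kind (u [])) (λ i → u (i ∷ [])) → LocalWF u
ChildrenOf⇒LocalWF u w with u []
... | nothing       = w
... | just (varL _) = w
... | just lamL     = w
... | just appL     = w

term-wellFormed : (t : Term) → WellFormed (tree t)
term-wellFormed t p =
  shape⇒WellFormedAt (tree t) p (cong (tree t) (sym (++-identityʳ p)))
    (LocalWF⇒ChildrenOf (subtree p (tree t)) (proj₂ (isTerm t) p))

wellFormed⇒LocalWF : ∀ {v : Tree} → WellFormed v → ∀ p → LocalWF (subtree p v)
wellFormed⇒LocalWF {v} w p =
  ChildrenOf⇒LocalWF (subtree p v) (shapeAt w p (cong v (sym (++-identityʳ p))))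

SameSupport : (ℕ → Maybe Label) → (ℕ → Maybe Label) → Set
SameSupport c c′ = ∀ i → is-just (c i) ≡ is-just (c′ i)

absent-resp : ∀ {m m′ : Maybe Label} → is-just m ≡ is-just m′ → m ≡ nothing → m′ ≡ nothing
absent-resp {m′ = nothing} _  _    = refl
absent-resp {m′ = just _}  () refl

Defined-resp : ∀ {m m′ : Maybe Label} → is-just m ≡ is-just m′ → Defined m → Defined m′
Defined-resp {m′ = just ℓ}  _  _          = ℓ , refl
Defined-resp {m′ = nothing} () (_ , refl)

is-just-kind : ∀ m → is-just m ≡ present (kind m)
is-just-kind nothing         = refl
is-just-kind (just (varL _)) = refl
is-just-kind (just lamL)     = refl
is-just-kind (just appL)     = refl

kind⇒is-just : ∀ {m m′} → kind m ≡ kind m′ → is-just m ≡ is-just m′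
kind⇒is-just {m} {m′} eq = trans (is-just-kind m) (trans (cong present eq) (sym (is-just-kind m′)))

ChildrenOf-resp : ∀ k {c c′} → SameSupport c c′ → ChildrenOf k c → ChildrenOf k c′
ChildrenOf-resp absent eq w            = λ i → absent-resp (eq i) (w i)
ChildrenOf-resp var    eq w            = λ i → absent-resp (eq i) (w i)
ChildrenOf-resp lam    eq (d₀ , w)     = Defined-resp (eq 0) d₀ , λ i i≢0 → absent-resp (eq i) (w i i≢0)
ChildrenOf-resp app    eq (d₁ , d₂ , w) =
  Defined-resp (eq 1) d₁ , Defined-resp (eq 2) d₂ , λ i i≢1 i≢2 → absent-resp (eq i) (w i i≢1 i≢2)

WellFormedAt-kind : ∀ {v v′ : Tree} {p} → (∀ q → kind (v q) ≡ kind (v′ q)) →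
                    WellFormedAt v′ p → WellFormedAt v p
WellFormedAt-kind {v} {v′} {p} v∼v′ w =
  ChildrenOf-resp (kind (v p)) (λ i → kind⇒is-just (sym (v∼v′ (p ++ i ∷ []))))
    (subst (λ k → ChildrenOf k (λ i → v′ (p ++ i ∷ []))) (sym (v∼v′ p)) w)

WellFormedAt-≗ : ∀ {v v′ : Tree} {p} → (∀ q → v q ≡ v′ q) → WellFormedAt v′ p → WellFormedAt v p
WellFormedAt-≗ v≗v′ = WellFormedAt-kind (λ q → cong kind (v≗v′ q))

WellFormed-child : ∀ {v : Tree} i → WellFormed v → WellFormed (child i v)
WellFormed-child i w p = w (i ∷ p)

WellFormed-node : ∀ {v : Tree} → WellFormedAt v [] → (∀ i → WellFormed (child i v)) → WellFormed v
WellFormed-node root _  []      = root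
WellFormed-node _    wf (i ∷ p) = wf i p

WellFormed-leaf : ∀ {v : Tree} {x} → v [] ≡ just (varL x) → (∀ i q → v (i ∷ q) ≡ nothing) → WellFormed v
WellFormed-leaf {v} root leaf []      = shape⇒WellFormedAt v [] root (λ i → leaf i [])
WellFormed-leaf {v} root leaf (i ∷ p) = shape⇒WellFormedAt v (i ∷ p) (leaf i p) (λ j → leaf i (p ++ j ∷ []))

absent-subtrees : ∀ {v : Tree} → WellFormed v → v [] ≡ nothing → ∀ q → v q ≡ nothing
absent-subtrees w v[]≡nothing []      = v[]≡nothing
absent-subtrees w v[]≡nothing (i ∷ q) =
  absent-subtrees (WellFormed-child i w) (shapeAt w [] v[]≡nothing i) q

Defined-root : ∀ {v : Tree} → WellFormed v → ∀ p → Defined (v p) → Defined (v [])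
Defined-root {v} w p (_ , vp≡just) with v [] in e
... | just ℓ  = ℓ , refl
... | nothing with () ← trans (sym vp≡just) (absent-subtrees w e p)

under : Maybe Label → ℕ → ℕ → ℕ
under (just lamL) i e = if i ≡ᵇ 0 then suc e else e
under _           _ e = e

shiftLab-child : ∀ d e s i q → shiftLab d e s (i ∷ q) ≡ shiftLab d (under (s []) i e) (child i s) q
shiftLab-child d e s i q with s []
... | nothing       = refl
... | just (varL _) = refl
... | just lamL     = refl
... | just appL     = refl

kind-shiftLab : ∀ d e s q → kind (shiftLab d e s q) ≡ kind (s q)
kind-shiftLab d e s [] with s []
... | nothing       = refl
... | just (varL _) = refl
... | just lamL     = refl
... | just appL     = refl
kind-shiftLab d e s (i ∷ q) =
  trans (cong kind (shiftLab-child d e s i q)) (kind-shiftLab d _ (child i s) q)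

WellFormed-shiftLab : ∀ d e {s} → WellFormed s → WellFormed (shiftLab d e s)
WellFormed-shiftLab d e {s} w p = WellFormedAt-kind (kind-shiftLab d e s) (w p)

shiftIndex : ℕ → ℕ → ℕ → ℕ
shiftIndex d e x = if x <ᵇ e then x else x + d

lowerVar : ℕ → ℕ → ℕ
lowerVar d n = if n <ᵇ d then n else n ∸ 1

module _ (d e : ℕ) (s : Tree) where

  shiftLab-var-root : ∀ {x} → s [] ≡ just (varL x) → shiftLab d e s [] ≡ just (varL (shiftIndex d e x))
  shiftLab-var-root root rewrite root = refl

  shiftLab-lam-root : s [] ≡ just lamL → shiftLab d e s [] ≡ just lamL
  shiftLab-lam-root root rewrite root = refl

  shiftLab-lam-body : s [] ≡ just lamL → ∀ q → shiftLab d e s (0 ∷ q) ≡ shiftLab d (suc e) (child 0 s) q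
  shiftLab-lam-body root q rewrite root = refl

  shiftLab-app-root : s [] ≡ just appL → shiftLab d e s [] ≡ just appL
  shiftLab-app-root root rewrite root = refl

  shiftLab-app-child : s [] ≡ just appL → ∀ i q → shiftLab d e s (i ∷ q) ≡ shiftLab d e (child i s) q
  shiftLab-app-child root i q rewrite root = refl

module _ (d : ℕ) (r s : Tree) where

  substLab-hit : ∀ {n} → r [] ≡ just (varL n) → (n ≡ᵇ d) ≡ true →
                 ∀ q → substLab d r s q ≡ shiftLab d 0 s q
  substLab-hit root hit q rewrite root | hit = refl

  substLab-miss-root : ∀ {n} → r [] ≡ just (varL n) → (n ≡ᵇ d) ≡ false →
                       substLab d r s [] ≡ just (varL (lowerVar d n))
  substLab-miss-root root miss rewrite root | miss = refl

  substLab-miss-child : ∀ {n} → r [] ≡ just (varL n) → (n ≡ᵇ d) ≡ false →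
                        ∀ i q → substLab d r s (i ∷ q) ≡ nothing
  substLab-miss-child root miss i q rewrite root | miss = refl

  substLab-lam-root : r [] ≡ just lamL → substLab d r s [] ≡ just lamL
  substLab-lam-root root rewrite root = refl

  substLab-lam-child : r [] ≡ just lamL →
                       ∀ i q → substLab d r s (i ∷ q) ≡ substLab (under (just lamL) i d) (child i r) s q
  substLab-lam-child root i q rewrite root = refl

  substLab-app-root : r [] ≡ just appL → substLab d r s [] ≡ just appL
  substLab-app-root root rewrite root = refl

  substLab-app-child : r [] ≡ just appL → ∀ i q → substLab d r s (i ∷ q) ≡ substLab d (child i r) s q
  substLab-app-child root i q rewrite root = refl

substLab-absent : ∀ d {r} s → WellFormed r → r [] ≡ nothing → ∀ q → substLab d r s q ≡ nothing
substLab-absent d s w root [] rewrite root = refl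
substLab-absent d s w root (i ∷ q) rewrite root =
  substLab-absent d s (WellFormed-child i w) (absent-subtrees w root (i ∷ [])) q

Defined-substLab-root : ∀ d r s → Defined (r []) → Defined (s []) → Defined (substLab d r s [])
Defined-substLab-root d r s (varL n , root) (_ , s-root) with n ≡ᵇ d in hit
... | true  = Defined-resp (kind⇒is-just (sym (trans (cong kind (substLab-hit d r s root hit []))
                                                     (kind-shiftLab d 0 s []))))
                (_ , s-root)
... | false = _ , substLab-miss-root d r s root hit
Defined-substLab-root d r s (lamL , root) _ = _ , substLab-lam-root d r s root
Defined-substLab-root d r s (appL , root) _ = _ , substLab-app-root d r s root

WellFormed-substLab : ∀ d {r s} → WellFormed r → WellFormed s → Defined (s []) → WellFormed (substLab d r s)
WellFormed-substLab d {r} {s} wr ws ds p = byRoot (r []) refl p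
  where
  byRoot : ∀ m → r [] ≡ m → ∀ p → WellFormedAt (substLab d r s) p
  byRoot nothing root p = WellFormedAt-≗ (substLab-absent d s wr root) (λ i → refl)
  byRoot (just (varL n)) root p with n ≡ᵇ d in hit
  ... | true  = WellFormedAt-≗ (substLab-hit d r s root hit) (WellFormed-shiftLab d 0 ws p)
  ... | false = WellFormed-leaf {substLab d r s} (substLab-miss-root d r s root hit)
                  (substLab-miss-child d r s root hit) p
  byRoot (just lamL) root [] =
    shape⇒WellFormedAt (substLab d r s) [] (substLab-lam-root d r s root)
      ( subst Defined (sym (substLab-lam-child d r s root 0 [])) (Defined-substLab-root (suc d) (child 0 r) s d₀ ds)
      , λ i i≢0 → trans (substLab-lam-child d r s root i [])
                        (substLab-absent _ s (WellFormed-child i wr) (others i i≢0) []))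
    where
    d₀     = proj₁ (shapeAt wr [] root)
    others = proj₂ (shapeAt wr [] root)
  byRoot (just lamL) root (i ∷ q) =
    WellFormedAt-≗ (substLab-lam-child d r s root i) (WellFormed-substLab _ (WellFormed-child i wr) ws ds q)
  byRoot (just appL) root [] =
    shape⇒WellFormedAt (substLab d r s) [] (substLab-app-root d r s root)
      ( subst Defined (sym (substLab-app-child d r s root 1 [])) (Defined-substLab-root d (child 1 r) s d₁ ds)
      , subst Defined (sym (substLab-app-child d r s root 2 [])) (Defined-substLab-root d (child 2 r) s d₂ ds)
      , λ i i≢1 i≢2 → trans (substLab-app-child d r s root i [])
                            (substLab-absent d s (WellFormed-child i wr) (others i i≢1 i≢2) []))
    where
    d₁     = proj₁ (shapeAt wr [] root)
    d₂     = proj₁ (proj₂ (shapeAt wr [] root))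
    others = proj₂ (proj₂ (shapeAt wr [] root))
  byRoot (just appL) root (i ∷ q) =
    WellFormedAt-≗ (substLab-app-child d r s root i) (WellFormed-substLab d (WellFormed-child i wr) ws ds q)

contract : List ℕ → Tree → Tree
contract []      u q       = substLab 0 (child 0 (child 1 u)) (child 2 u) q
contract (i ∷ p) u []      = u []
contract (i ∷ p) u (j ∷ q) with i ≟ j
... | yes refl = contract p (child i u) q
... | no _     = u (j ∷ q)

contract-inside : ∀ p u q → contract p u (p ++ q) ≡
  substLab 0 (subtree (p ++ 1 ∷ 0 ∷ []) u) (subtree (p ++ 2 ∷ []) u) q
contract-inside []      u q = refl
contract-inside (i ∷ p) u q with i ≟ i
... | yes refl = contract-inside p (child i u) q
... | no i≢i   = contradiction refl i≢i

contract-outside : ∀ p u q → (∀ q′ → q ≢ p ++ q′) → contract p u q ≡ u q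
contract-outside []      u q       q∉p = contradiction refl (q∉p q)
contract-outside (i ∷ p) u []      q∉p = refl
contract-outside (i ∷ p) u (j ∷ q) q∉p with i ≟ j
... | yes refl = contract-outside p (child i u) q (λ q′ eq → q∉p q′ (cong (i ∷_) eq))
... | no _     = refl

β-contract : ∀ {p u} → u p ≡ just appL → u (p ++ 1 ∷ []) ≡ just lamL → BetaAt p u (contract p u)
β-contract {p} {u} isApp isLam = record
  { redexApp = isApp
  ; redexLam = isLam
  ; inside   = contract-inside p u
  ; outside  = contract-outside p u
  }

redex-shape : ∀ {u : Tree} → WellFormed u → u [] ≡ just appL → u (1 ∷ []) ≡ just lamL →
              Defined (u (1 ∷ 0 ∷ [])) × Defined (u (2 ∷ []))
redex-shape w isApp isLam =
  proj₁ (shapeAt w (1 ∷ []) isLam) , proj₁ (proj₂ (shapeAt w [] isApp))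

Defined-contract-root : ∀ p {u : Tree} → WellFormed u → u p ≡ just appL → u (p ++ 1 ∷ []) ≡ just lamL →
                        Defined (contract p u [])
Defined-contract-root []      {u} w isApp isLam =
  let (d₀ , d₂) = redex-shape w isApp isLam in Defined-substLab-root 0 (child 0 (child 1 u)) (child 2 u) d₀ d₂
Defined-contract-root (i ∷ p) w isApp _ = Defined-root w (i ∷ p) (_ , isApp)

WellFormed-contract : ∀ p {u : Tree} → WellFormed u → u p ≡ just appL → u (p ++ 1 ∷ []) ≡ just lamL →
                      WellFormed (contract p u)
WellFormed-contract [] w isApp isLam =
  WellFormed-substLab 0 (WellFormed-child 0 (WellFormed-child 1 w)) (WellFormed-child 2 w)
    (proj₂ (redex-shape w isApp isLam))
WellFormed-contract (i ∷ p) {u} w isApp isLam =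
  WellFormed-node (ChildrenOf-resp (kind (u [])) sameSupport (w [])) children
  where
  sameSupport : SameSupport (λ j → u (j ∷ [])) (λ j → contract (i ∷ p) u (j ∷ []))
  sameSupport j with i ≟ j
  ... | no _     = refl
  ... | yes refl
    with Defined-root (WellFormed-child i w) p (_ , isApp)
       | Defined-contract-root p (WellFormed-child i w) isApp isLam
  ...   | _ , e | _ , e′ rewrite e | e′ = refl
  children : ∀ j → WellFormed (child j (contract (i ∷ p) u))
  children j with i ≟ j
  ... | yes refl = WellFormed-contract p (WellFormed-child i w) isApp isLam
  ... | no _     = WellFormed-child j w

contractTerm : (t : Term) (p : List ℕ) → tree t p ≡ just appL → tree t (p ++ 1 ∷ []) ≡ just lamL → Term
contractTerm t p isApp isLam = mkTerm (contract p (tree t))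
  ( Defined-contract-root p (term-wellFormed t) isApp isLam
  , wellFormed⇒LocalWF (WellFormed-contract p (term-wellFormed t) isApp isLam))

concatMap-↭ : {A B : Set} (f : A → List B) {xs ys : List A} → xs ↭ ys → concatMap f xs ↭ concatMap f ys
concatMap-↭ f ↭.refl        = ↭-refl
concatMap-↭ f (prep x p)    = ↭ₚ.++⁺ˡ (f x) (concatMap-↭ f p)
concatMap-↭ f (swap x y p)  = ↭-trans (↭ₚ.++⁺ˡ (f x) (↭ₚ.++⁺ˡ (f y) (concatMap-↭ f p))) (↭ₚ.shifts (f x) (f y))
concatMap-↭ f (↭.trans p q) = ↭-trans (concatMap-↭ f p) (concatMap-↭ f q)

Unique-∷ : {A : Set} {x : A} {xs : List A} → x ∉ xs → Unique xs → Unique (x ∷ xs)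
Unique-∷ {xs = xs} x∉xs u = ¬Any⇒All¬ xs x∉xs ∷ u

Unique-tail : {A : Set} {x : A} {xs : List A} → Unique (x ∷ xs) → Unique xs
Unique-tail (_ ∷ u) = u

above⇒nonzero : ∀ y d → (y ≡ᵇ d) ≡ false → (y <ᵇ d) ≡ false → (y ≡ᵇ 0) ≡ false
above⇒nonzero zero    zero    () _
above⇒nonzero zero    (suc d) _  ()
above⇒nonzero (suc y) d       _  _ = refl

module _ {X : Set} where

  typeAt : ℕ → ℕ × X → List X
  typeAt d (x , a) = if x ≡ᵇ d then a ∷ [] else []

  entryWithout : ℕ → ℕ × X → List (ℕ × X)
  entryWithout d (x , a) = if x ≡ᵇ d then [] else (lowerVar d x , a) ∷ []

  typesOf : ℕ → List (ℕ × X) → List X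
  typesOf d = concatMap (typeAt d)

  removeVar : ℕ → List (ℕ × X) → List (ℕ × X)
  removeVar d = concatMap (entryWithout d)

  shiftVar : ℕ → ℕ → ℕ × X → ℕ × X
  shiftVar d e (x , a) = shiftIndex d e x , a

  shiftCtx : ℕ → ℕ → List (ℕ × X) → List (ℕ × X)
  shiftCtx d e = map (shiftVar d e)

  typesOf-removeVar0 : ∀ d Γ → typesOf d (removeVar 0 Γ) ≡ typesOf (suc d) Γ
  typesOf-removeVar0 d [] = refl
  typesOf-removeVar0 d ((zero , a) ∷ Γ) = typesOf-removeVar0 d Γ
  typesOf-removeVar0 d ((suc y , a) ∷ Γ) with y ≡ᵇ d
  ... | true  = cong (a ∷_) (typesOf-removeVar0 d Γ)
  ... | false = typesOf-removeVar0 d Γ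

  typesOf0-removeVar-suc : ∀ d Γ → typesOf 0 (removeVar (suc d) Γ) ≡ typesOf 0 Γ
  typesOf0-removeVar-suc d [] = refl
  typesOf0-removeVar-suc d ((zero , a) ∷ Γ) = cong (a ∷_) (typesOf0-removeVar-suc d Γ)
  typesOf0-removeVar-suc d ((suc y , a) ∷ Γ) with y ≡ᵇ d in hit | y <ᵇ d in below
  ... | true  | _     = typesOf0-removeVar-suc d Γ
  ... | false | true  = typesOf0-removeVar-suc d Γ
  ... | false | false rewrite above⇒nonzero y d hit below = typesOf0-removeVar-suc d Γ

  removeVar0-removeVar-suc : ∀ d Γ → removeVar 0 (removeVar (suc d) Γ) ≡ removeVar d (removeVar 0 Γ)
  removeVar0-removeVar-suc d [] = refl
  removeVar0-removeVar-suc d ((zero , a) ∷ Γ) = removeVar0-removeVar-suc d Γ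
  removeVar0-removeVar-suc d ((suc y , a) ∷ Γ) with y ≡ᵇ d in hit | y <ᵇ d in below
  ... | true  | _     = removeVar0-removeVar-suc d Γ
  ... | false | true  = cong ((y , a) ∷_) (removeVar0-removeVar-suc d Γ)
  ... | false | false rewrite above⇒nonzero y d hit below =
    cong ((y ∸ 1 , a) ∷_) (removeVar0-removeVar-suc d Γ)

  typesOf0-shiftCtx-suc : ∀ d Γ → typesOf 0 (shiftCtx (suc d) 0 Γ) ≡ []
  typesOf0-shiftCtx-suc d [] = refl
  typesOf0-shiftCtx-suc d ((x , a) ∷ Γ) rewrite +-suc x d = typesOf0-shiftCtx-suc d Γ

  removeVar0-shiftCtx-suc : ∀ d Γ → removeVar 0 (shiftCtx (suc d) 0 Γ) ≡ shiftCtx d 0 Γ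
  removeVar0-shiftCtx-suc d [] = refl
  removeVar0-shiftCtx-suc d ((x , a) ∷ Γ) rewrite +-suc x d = cong ((x + d , a) ∷_) (removeVar0-shiftCtx-suc d Γ)

  typesOf0-shiftCtx-under : ∀ d e Γ → typesOf 0 (shiftCtx d (suc e) Γ) ≡ typesOf 0 Γ
  typesOf0-shiftCtx-under d e [] = refl
  typesOf0-shiftCtx-under d e ((zero , a) ∷ Γ) = cong (a ∷_) (typesOf0-shiftCtx-under d e Γ)
  typesOf0-shiftCtx-under d e ((suc y , a) ∷ Γ) with y <ᵇ e
  ... | true  = typesOf0-shiftCtx-under d e Γ
  ... | false = typesOf0-shiftCtx-under d e Γ

  removeVar0-shiftCtx-under : ∀ d e Γ → removeVar 0 (shiftCtx d (suc e) Γ) ≡ shiftCtx d e (removeVar 0 Γ)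
  removeVar0-shiftCtx-under d e [] = refl
  removeVar0-shiftCtx-under d e ((zero , a) ∷ Γ) = removeVar0-shiftCtx-under d e Γ
  removeVar0-shiftCtx-under d e ((suc y , a) ∷ Γ) with y <ᵇ e
  ... | true  = cong ((y , a) ∷_) (removeVar0-shiftCtx-under d e Γ)
  ... | false = cong ((y + d , a) ∷_) (removeVar0-shiftCtx-under d e Γ)

  shiftCtx-zero : ∀ Γ → shiftCtx 0 0 Γ ≡ Γ
  shiftCtx-zero [] = refl
  shiftCtx-zero ((x , a) ∷ Γ) = cong₂ _∷_ (cong (_, a) (+-identityʳ x)) (shiftCtx-zero Γ)

  ∈-typesOf0⁺ : ∀ {Γ : List (ℕ × X)} {a} → (0 , a) ∈ Γ → a ∈ typesOf 0 Γ
  ∈-typesOf0⁺ {(zero , _) ∷ _} (here refl) = here refl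
  ∈-typesOf0⁺ {(zero , _) ∷ _} (there a∈) = there (∈-typesOf0⁺ a∈)
  ∈-typesOf0⁺ {(suc _ , _) ∷ _} (there a∈) = ∈-typesOf0⁺ a∈

  ∈-typesOf0⁻ : ∀ {Γ : List (ℕ × X)} {a} → a ∈ typesOf 0 Γ → (0 , a) ∈ Γ
  ∈-typesOf0⁻ {(zero , _) ∷ _} (here refl) = here refl
  ∈-typesOf0⁻ {(zero , _) ∷ _} (there a∈) = there (∈-typesOf0⁻ a∈)
  ∈-typesOf0⁻ {(suc _ , _) ∷ _} a∈ = there (∈-typesOf0⁻ a∈)

  typesOf0-unique : ∀ {Γ : List (ℕ × X)} → Unique Γ → Unique (typesOf 0 Γ)
  typesOf0-unique {[]} _ = []
  typesOf0-unique {(zero , a) ∷ Γ} u =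
    Unique-∷ (λ a∈ → Unique.Unique[x∷xs]⇒x∉xs u (∈-typesOf0⁻ a∈)) (typesOf0-unique (Unique-tail u))
  typesOf0-unique {(suc _ , _) ∷ Γ} u = typesOf0-unique (Unique-tail u)

  ∈-removeVar0⁺ : ∀ {Γ : List (ℕ × X)} {y a} → (suc y , a) ∈ Γ → (y , a) ∈ removeVar 0 Γ
  ∈-removeVar0⁺ {(suc _ , _) ∷ _} (here refl) = here refl
  ∈-removeVar0⁺ {(zero , _) ∷ _} (there e∈) = ∈-removeVar0⁺ e∈
  ∈-removeVar0⁺ {(suc _ , _) ∷ _} (there e∈) = there (∈-removeVar0⁺ e∈)

  ∈-removeVar0⁻ : ∀ {Γ : List (ℕ × X)} {y a} → (y , a) ∈ removeVar 0 Γ → (suc y , a) ∈ Γ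
  ∈-removeVar0⁻ {(zero , _) ∷ _} e∈ = there (∈-removeVar0⁻ e∈)
  ∈-removeVar0⁻ {(suc _ , _) ∷ _} (here refl) = here refl
  ∈-removeVar0⁻ {(suc _ , _) ∷ _} (there e∈) = there (∈-removeVar0⁻ e∈)

  removeVar0-unique : ∀ {Γ : List (ℕ × X)} → Unique Γ → Unique (removeVar 0 Γ)
  removeVar0-unique {[]} _ = []
  removeVar0-unique {(zero , _) ∷ Γ} u = removeVar0-unique (Unique-tail u)
  removeVar0-unique {(suc _ , _) ∷ Γ} u =
    Unique-∷ (λ e∈ → Unique.Unique[x∷xs]⇒x∉xs u (∈-removeVar0⁻ e∈)) (removeVar0-unique (Unique-tail u))

module _ {X Y : Set} (f : X → Y) where

  typesOf-map₂ : ∀ d Γ → typesOf d (map (map₂ f) Γ) ≡ map f (typesOf d Γ)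
  typesOf-map₂ d [] = refl
  typesOf-map₂ d ((x , a) ∷ Γ) with x ≡ᵇ d
  ... | true  = cong (f a ∷_) (typesOf-map₂ d Γ)
  ... | false = typesOf-map₂ d Γ

  removeVar-map₂ : ∀ d Γ → removeVar d (map (map₂ f) Γ) ≡ map (map₂ f) (removeVar d Γ)
  removeVar-map₂ d [] = refl
  removeVar-map₂ d ((x , a) ∷ Γ) with x ≡ᵇ d
  ... | true  = removeVar-map₂ d Γ
  ... | false = cong ((lowerVar d x , f a) ∷_) (removeVar-map₂ d Γ)

data Type : Set where
  base : Type
  _⊸_  : List Type → Type → Type

Context : Set
Context = List (ℕ × Type)

module ++ₚ = CommutativeSemigroupProperties (CommutativeMonoid.commutativeSemigroup (↭ₚ.++-commutativeMonoid {A = ℕ × Type}))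

-- Deriv with the tracks forgotten; the index counts the rules of the derivation.
data Der : Context → Tree → Type → ℕ → Set
data Ders : List Context → Tree → List Type → ℕ → Set

data Der where
  ax  : ∀ {t x A} → t [] ≡ just (varL x) → Der ((x , A) ∷ []) t A 1
  abs : ∀ {Γ t A L n} → t [] ≡ just lamL → Der Γ (child 0 t) A n → typesOf 0 Γ ↭ L →
        Der (removeVar 0 Γ) t (L ⊸ A) (suc n)
  app : ∀ {Γ Δs t L A n m} → t [] ≡ just appL → Der Γ (child 1 t) (L ⊸ A) n →
        Ders Δs (child 2 t) L m → Der (Γ ++ concat Δs) t A (suc (n + m))

data Ders where
  []  : ∀ {t} → Ders [] t [] 0
  _∷_ : ∀ {Δ Δs t A L n m} → Der Δ t A n → Ders Δs t L m → Ders (Δ ∷ Δs) t (A ∷ L) (n + m)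

Der-≗ : ∀ {Γ u v A n} → (∀ q → u q ≡ v q) → Der Γ u A n → Der Γ v A n
Ders-≗ : ∀ {Δs u v L n} → (∀ q → u q ≡ v q) → Ders Δs u L n → Ders Δs v L n
Der-≗ u≗v (ax root)       = ax (trans (sym (u≗v [])) root)
Der-≗ u≗v (abs root D p)  = abs (trans (sym (u≗v [])) root) (Der-≗ (λ q → u≗v (0 ∷ q)) D) p
Der-≗ u≗v (app root D Ds) =
  app (trans (sym (u≗v [])) root) (Der-≗ (λ q → u≗v (1 ∷ q)) D) (Ders-≗ (λ q → u≗v (2 ∷ q)) Ds)
Ders-≗ u≗v []       = []
Ders-≗ u≗v (D ∷ Ds) = Der-≗ u≗v D ∷ Ders-≗ u≗v Ds

shift-Der : ∀ d e {Δ s A n} → Der Δ s A n → Der (shiftCtx d e Δ) (shiftLab d e s) A n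
shift-Ders : ∀ d e {Δs s L n} → Ders Δs s L n → Ders (map (shiftCtx d e) Δs) (shiftLab d e s) L n
shift-Der d e {s = s} (ax root) = ax (shiftLab-var-root d e s root)
shift-Der d e {s = s} (abs {Γ = Γ} root D p) =
  subst (λ Γ′ → Der Γ′ (shiftLab d e s) _ _) (removeVar0-shiftCtx-under d e Γ)
    (abs (shiftLab-lam-root d e s root)
         (Der-≗ (λ q → sym (shiftLab-lam-body d e s root q)) (shift-Der d (suc e) D))
         (↭-trans (↭-reflexive (typesOf0-shiftCtx-under d e Γ)) p))
shift-Der d e {s = s} (app {Γ = Γ} {Δs = Δs} root D Ds) =
  subst (λ Γ′ → Der Γ′ (shiftLab d e s) _ _) shiftCtx-app
    (app (shiftLab-app-root d e s root)
         (Der-≗ (λ q → sym (shiftLab-app-child d e s root 1 q)) (shift-Der d e D))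
         (Ders-≗ (λ q → sym (shiftLab-app-child d e s root 2 q)) (shift-Ders d e Ds)))
  where
  shiftCtx-app : shiftCtx d e Γ ++ concat (map (shiftCtx d e) Δs) ≡ shiftCtx d e (Γ ++ concat Δs)
  shiftCtx-app = trans (cong (shiftCtx d e Γ ++_) (concat-map Δs)) (sym (map-++ _ Γ (concat Δs)))
shift-Ders d e []       = []
shift-Ders d e (D ∷ Ds) = shift-Der d e D ∷ shift-Ders d e Ds

record Split (Δs : List Context) (s : Tree) (L₁ L₂ : List Type) (m : ℕ) : Set where
  constructor split
  field
    {Δs₁ Δs₂} : List Context
    {m₁ m₂}   : ℕ
    left      : Ders Δs₁ s L₁ m₁
    right     : Ders Δs₂ s L₂ m₂
    Δs≡       : Δs ≡ Δs₁ ++ Δs₂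
    m≡        : m ≡ m₁ + m₂

Ders-split : ∀ {Δs s m} L₁ {L₂} → Ders Δs s (L₁ ++ L₂) m → Split Δs s L₁ L₂ m
Ders-split []       Ds       = split [] Ds refl refl
Ders-split (A ∷ L₁) (_∷_ {n = n} D Ds) with Ders-split L₁ Ds
... | split {m₁ = m₁} {m₂} Ds₁ Ds₂ refl refl = split (D ∷ Ds₁) Ds₂ refl (sym (+-assoc n m₁ m₂))

Ders-↭ : ∀ {Δs s L L′ m} → Ders Δs s L m → L ↭ L′ →
         Σ (List Context) λ Δs′ → Ders Δs′ s L′ m × concat Δs′ ↭ concat Δs
Ders-↭ Ds ↭.refl = _ , Ds , ↭-refl
Ders-↭ (D ∷ Ds) (prep _ p) with Ders-↭ Ds p
... | _ , Ds′ , ↭Δs = _ , D ∷ Ds′ , ↭ₚ.++⁺ˡ _ ↭Δs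
Ders-↭ (_∷_ {Δ = Δ₁} {n = n₁} D₁ (_∷_ {Δ = Δ₂} {n = n₂} {m = m} D₂ Ds)) (swap _ _ p) with Ders-↭ Ds p
... | _ , Ds′ , ↭Δs =
  _ , subst (Ders _ _ _) (+ₚ.x∙yz≈y∙xz n₂ n₁ m) (D₂ ∷ D₁ ∷ Ds′) ,
  ↭-trans (↭ₚ.++⁺ˡ Δ₂ (↭ₚ.++⁺ˡ Δ₁ ↭Δs)) (↭ₚ.shifts Δ₂ Δ₁)
Ders-↭ Ds (↭.trans p q) with Ders-↭ Ds p
... | _ , Ds₁ , ↭₁ with Ders-↭ Ds₁ q
... | _ , Ds₂ , ↭₂ = _ , Ds₂ , ↭-trans ↭₂ ↭₁

record Typable (Γ : Context) (u : Tree) (A : Type) (bound : ℕ) : Set where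
  constructor typable
  field
    {context}  : Context
    {size}     : ℕ
    context↭   : context ↭ Γ
    size<      : size < bound
    derivation : Der context u A size

record Typable* (Γ : Context) (u : Tree) (L : List Type) (bound : ℕ) : Set where
  constructor typable*
  field
    {contexts}  : List Context
    {size}      : ℕ
    contexts↭   : concat contexts ↭ Γ
    size<       : size < bound
    derivations : Ders contexts u L size

substCtx : ℕ → Context → List Context → Context
substCtx d Γ Ds = removeVar d Γ ++ shiftCtx d 0 (concat Ds)

substCtx-++ : ∀ d {E₁ E₂} Γ₁ Γ₂ Ds₁ Ds₂ → E₁ ↭ substCtx d Γ₁ Ds₁ → E₂ ↭ substCtx d Γ₂ Ds₂ →
              E₁ ++ E₂ ↭ substCtx d (Γ₁ ++ Γ₂) (Ds₁ ++ Ds₂)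
substCtx-++ d Γ₁ Γ₂ Ds₁ Ds₂ p₁ p₂ =
  ↭-trans (↭ₚ.++⁺ p₁ p₂)
    (↭-trans (++ₚ.interchange (removeVar d Γ₁) _ (removeVar d Γ₂) _)
      (↭-reflexive (cong₂ _++_ (sym (concatMap-++ _ Γ₁ Γ₂))
                               (trans (sym (map-++ _ (concat Ds₁) (concat Ds₂)))
                                      (cong (shiftCtx d 0) (concat-++ Ds₁ Ds₂))))))

typesOf0-substCtx-suc : ∀ d Γ Ds → typesOf 0 (substCtx (suc d) Γ Ds) ≡ typesOf 0 Γ
typesOf0-substCtx-suc d Γ Ds = begin
  typesOf 0 (removeVar (suc d) Γ ++ shiftCtx (suc d) 0 (concat Ds))
    ≡⟨ concatMap-++ _ (removeVar (suc d) Γ) _ ⟩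
  typesOf 0 (removeVar (suc d) Γ) ++ typesOf 0 (shiftCtx (suc d) 0 (concat Ds))
    ≡⟨ cong₂ _++_ (typesOf0-removeVar-suc d Γ) (typesOf0-shiftCtx-suc d (concat Ds)) ⟩
  typesOf 0 Γ ++ []
    ≡⟨ ++-identityʳ _ ⟩
  typesOf 0 Γ ∎
  where open ≡-Reasoning

removeVar0-substCtx-suc : ∀ d Γ Ds → removeVar 0 (substCtx (suc d) Γ Ds) ≡ substCtx d (removeVar 0 Γ) Ds
removeVar0-substCtx-suc d Γ Ds = begin
  removeVar 0 (removeVar (suc d) Γ ++ shiftCtx (suc d) 0 (concat Ds))
    ≡⟨ concatMap-++ _ (removeVar (suc d) Γ) _ ⟩
  removeVar 0 (removeVar (suc d) Γ) ++ removeVar 0 (shiftCtx (suc d) 0 (concat Ds))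
    ≡⟨ cong₂ _++_ (removeVar0-removeVar-suc d Γ) (removeVar0-shiftCtx-suc d (concat Ds)) ⟩
  removeVar d (removeVar 0 Γ) ++ shiftCtx d 0 (concat Ds) ∎
  where open ≡-Reasoning

size-sum : ∀ {k₁ k₂} n₁ n₂ m₁ m₂ → k₁ < suc (n₁ + m₁) → k₂ < suc (n₂ + m₂) → k₁ + k₂ < suc ((n₁ + n₂) + (m₁ + m₂))
size-sum n₁ n₂ m₁ m₂ (s≤s p₁) (s≤s p₂) =
  s≤s (≤-trans (+-mono-≤ p₁ p₂) (≤-reflexive (+ₚ.interchange n₁ m₁ n₂ m₂)))

-- Each axiom typing the variable d consumes one argument derivation, so the sizes add up.
substitution : ∀ d {Γ r A n Ds s m} → Der Γ r A n → Ders Ds s (typesOf d Γ) m →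
               Typable (substCtx d Γ Ds) (substLab d r s) A (suc (n + m))
substitution* : ∀ d {Γs r L n Ds s m} → Ders Γs r L n → Ders Ds s (typesOf d (concat Γs)) m →
                Typable* (substCtx d (concat Γs) Ds) (substLab d r s) L (suc (n + m))
substitution d {r = r} {s = s} (ax {x = x} root) DS with x ≡ᵇ d in hit
substitution d {r = r} {s = s} (ax {x = x} root) (_∷_ {Δ = Δ} D₀ []) | true =
  typable (↭-reflexive (cong (shiftCtx d 0) (sym (++-identityʳ Δ))))
    (s≤s (≤-trans (m≤m+n _ 0) (n≤1+n _)))
    (Der-≗ (λ q → sym (substLab-hit d r s root hit q)) (shift-Der d 0 D₀))
substitution d {r = r} {s = s} (ax root) [] | false =
  typable ↭-refl ≤-refl (ax (substLab-miss-root d r s root hit))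
substitution d {r = r} {Ds = Ds} {s = s} (abs {Γ = Γ} root D p) DS
  with substitution (suc d) D (subst (λ L → Ders _ _ L _) (typesOf-removeVar0 d Γ) DS)
... | typable ↭E (s≤s k≤n+m) D′ =
  typable (↭-trans (concatMap-↭ _ ↭E) (↭-reflexive (removeVar0-substCtx-suc d Γ Ds)))
    (s≤s (s≤s k≤n+m))
    (abs (substLab-lam-root d r s root) (Der-≗ (λ q → sym (substLab-lam-child d r s root 0 q)) D′)
         (↭-trans (concatMap-↭ _ ↭E) (↭-trans (↭-reflexive (typesOf0-substCtx-suc d Γ Ds)) p)))
substitution d {r = r} {s = s} (app {Γ = Γ} {Δs = Δs} {n = n₁} {m = n₂} root D Ds) DS
  with Ders-split (typesOf d Γ) (subst (λ L → Ders _ _ L _) (concatMap-++ _ Γ (concat Δs)) DS)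
... | split {Ds₁} {Ds₂} {m₁} {m₂} DS₁ DS₂ refl refl with substitution d D DS₁ | substitution* d Ds DS₂
... | typable ↭₁ <₁ D′ | typable* ↭₂ <₂ Ds′ =
  typable (substCtx-++ d Γ (concat Δs) Ds₁ Ds₂ ↭₁ ↭₂) (s≤s (size-sum n₁ n₂ m₁ m₂ <₁ <₂))
    (app (substLab-app-root d r s root)
         (Der-≗ (λ q → sym (substLab-app-child d r s root 1 q)) D′)
         (Ders-≗ (λ q → sym (substLab-app-child d r s root 2 q)) Ds′))
substitution* d [] [] = typable* ↭-refl (s≤s z≤n) []
substitution* d (_∷_ {Δ = Γ} {Δs = Γs} {n = n₁} {m = n₂} D Ds) DS
  with Ders-split (typesOf d Γ) (subst (λ L → Ders _ _ L _) (concatMap-++ _ Γ (concat Γs)) DS)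
... | split {Ds₁} {Ds₂} {m₁} {m₂} DS₁ DS₂ refl refl with substitution d D DS₁ | substitution* d Ds DS₂
... | typable ↭₁ <₁ D′ | typable* ↭₂ <₂ Ds′ =
  typable* (substCtx-++ d Γ (concat Γs) Ds₁ Ds₂ ↭₁ ↭₂) (size-sum n₁ n₂ m₁ m₂ <₁ <₂) (D′ ∷ Ds′)

Typable-abs : ∀ {Γ u A L n} → u [] ≡ just lamL → typesOf 0 Γ ↭ L →
              Typable Γ (child 0 u) A n → Typable (removeVar 0 Γ) u (L ⊸ A) (suc n)
Typable-abs root p (typable ↭Γ k<n D) =
  typable (concatMap-↭ _ ↭Γ) (s≤s k<n) (abs root D (↭-trans (concatMap-↭ _ ↭Γ) p))

Typable-app : ∀ {Γ Δs u L A n m} → u [] ≡ just appL → Typable Γ (child 1 u) (L ⊸ A) n →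
              Ders Δs (child 2 u) L m → Typable (Γ ++ concat Δs) u A (suc (n + m))
Typable-app root (typable ↭Γ k<n D) Ds =
  typable (↭ₚ.++⁺ʳ _ ↭Γ) (s≤s (+-monoˡ-≤ _ k<n)) (app root D Ds)

-- The abs and app rules of the redex disappear, hence the strict decrease.
headRedex-typable : ∀ {Γ Δs u u′ L A n m} → child 1 u [] ≡ just lamL → Der Γ (child 1 u) (L ⊸ A) n →
                 Ders Δs (child 2 u) L m → BetaAt [] u u′ → Typable (Γ ++ concat Δs) u′ A (suc (n + m))
headRedex-typable isLam (ax root) _ _ with () ← trans (sym root) isLam
headRedex-typable isLam (app root _ _) _ _ with () ← trans (sym root) isLam
headRedex-typable {Δs = Δs} {n = suc n} {m} _ (abs {Γ = Γ} _ D p) Ds β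
  with Ders-↭ Ds (↭-sym p)
... | Δs′ , Ds′ , ↭Δs with substitution 0 D Ds′
... | typable ↭Res k< D′ =
  typable (↭-trans ↭Res (↭ₚ.++⁺ˡ (removeVar 0 Γ) (↭-trans (↭-reflexive (shiftCtx-zero _)) ↭Δs)))
    (≤-trans k< (s≤s (n≤1+n (n + m))))
    (Der-≗ (λ q → sym (BetaAt.inside β q)) D′)

β-child : ∀ {i p u u′} → BetaAt (i ∷ p) u u′ → BetaAt p (child i u) (child i u′)
β-child β = record
  { redexApp = BetaAt.redexApp β
  ; redexLam = BetaAt.redexLam β
  ; inside   = BetaAt.inside β
  ; outside  = λ q q∉p → BetaAt.outside β (_ ∷ q) (λ q′ eq → q∉p q′ (∷-injectiveʳ eq))
  }

record HeadRedex (u : Tree) (Γ : Context) (A : Type) (n : ℕ) : Set where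
  field
    position : List ℕ
    isApp    : u position ≡ just appL
    isLam    : u (position ++ 1 ∷ []) ≡ just lamL
    reduct   : ∀ {u′} → BetaAt position u u′ → Typable Γ u′ A n

headStep : ∀ {Γ u A n} → Der Γ u A n → IsHNF u ⊎ HeadRedex u Γ A n
headStep (ax root) = inj₁ (hneu (nvar root))
headStep (abs root D p) with headStep D
... | inj₁ hnf = inj₁ (hlam root hnf)
... | inj₂ r = inj₂ (record
  { position = 0 ∷ position
  ; isApp    = isApp
  ; isLam    = isLam
  ; reduct   = λ β → Typable-abs (trans (BetaAt.outside β [] λ _ ()) root) p (reduct (β-child β))
  })
  where open HeadRedex r
headStep (app root D Ds) with headStep D
... | inj₁ (hneu ne)        = inj₁ (hneu (napp root ne))
... | inj₁ (hlam isLam _)   = inj₂ (record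
  { position = []
  ; isApp    = root
  ; isLam    = isLam
  ; reduct   = headRedex-typable isLam D Ds
  })
... | inj₂ r = inj₂ (record
  { position = 1 ∷ position
  ; isApp    = isApp
  ; isLam    = isLam
  ; reduct   = λ β → Typable-app (trans (BetaAt.outside β [] λ _ ()) root) (reduct (β-child β))
                       (Ders-≗ (λ q → sym (BetaAt.outside β (2 ∷ q) λ _ ())) Ds)
  })
  where open HeadRedex r

TypableOfSize : ℕ → Term → Set
TypableOfSize n t = Σ Context λ Γ → Σ Type λ A → Der Γ (tree t) A n

typable⇒headNormalizable : ∀ n (t : Term) → TypableOfSize n t → HeadNormalizable t
typable⇒headNormalizable = <-rec _ step
  where
  step : ∀ n → (∀ {m} → m < n → ∀ t → TypableOfSize m t → HeadNormalizable t) →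
         ∀ t → TypableOfSize n t → HeadNormalizable t
  step n rec t (_ , _ , D) with headStep D
  ... | inj₁ hnf = t , ε , hnf
  ... | inj₂ r   = contracted (reduct (β-contract isApp isLam))
    where
    open HeadRedex r
    contracted : Typable _ (contract position (tree t)) _ n → HeadNormalizable t
    contracted (typable _ k<n D′) with rec k<n (contractTerm t position isApp isLam) (_ , _ , D′)
    ... | t′ , t↠t′ , hnf = t′ , (position , β-contract isApp isLam) ◅ t↠t′ , hnf

erase : Ty → Type
eraseSeq : List (Maybe Ty) → List Type
erase (atom _) = base
erase (F ⇒ T)  = eraseSeq F ⊸ erase T
eraseSeq []            = []
eraseSeq (nothing ∷ F) = eraseSeq F
eraseSeq (just T ∷ F)  = erase T ∷ eraseSeq F

-- the component at track i + 2
component : List (Maybe Ty) → ℕ → Maybe Ty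
component []      _       = nothing
component (m ∷ F) zero    = m
component (m ∷ F) (suc i) = component F i

at-component : ∀ F i → at F (suc (suc i)) ≡ component F i
at-component []      i       = refl
at-component (m ∷ F) zero    = refl
at-component (m ∷ F) (suc i) = at-component F i

components : ℕ → List (Maybe Ty) → List (ℕ × Ty)
components k []            = []
components k (nothing ∷ F) = components (suc k) F
components k (just T ∷ F)  = (k , T) ∷ components (suc k) F

eraseSeq-components : ∀ k F → eraseSeq F ≡ map (erase ∘ proj₂) (components k F)
eraseSeq-components k []            = refl
eraseSeq-components k (nothing ∷ F) = eraseSeq-components (suc k) F
eraseSeq-components k (just T ∷ F)  = cong (erase T ∷_) (eraseSeq-components (suc k) F)

∈-components⁺ : ∀ k F i {T} → component F i ≡ just T → (k + i , T) ∈ components k F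
∈-components⁺ k (just T ∷ F) zero refl rewrite +-identityʳ k = here refl
∈-components⁺ k (nothing ∷ F) (suc i) eq rewrite +-suc k i = ∈-components⁺ (suc k) F i eq
∈-components⁺ k (just _ ∷ F) (suc i) eq rewrite +-suc k i = there (∈-components⁺ (suc k) F i eq)

∈-components⁻ : ∀ k F {j T} → (j , T) ∈ components k F → Σ ℕ λ i → j ≡ k + i × component F i ≡ just T
∈-components⁻ k (nothing ∷ F) j∈ with ∈-components⁻ (suc k) F j∈
... | i , refl , eq = suc i , sym (+-suc k i) , eq
∈-components⁻ k (just T ∷ F) (here refl) = 0 , sym (+-identityʳ k) , refl
∈-components⁻ k (just T ∷ F) (there j∈) with ∈-components⁻ (suc k) F j∈
... | i , refl , eq = suc i , sym (+-suc k i) , eq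

components-unique : ∀ k F → Unique (components k F)
components-unique k []            = []
components-unique k (nothing ∷ F) = components-unique (suc k) F
components-unique k (just T ∷ F)  = Unique-∷ k∉ (components-unique (suc k) F)
  where
  k∉ : (k , T) ∈ components (suc k) F → ⊥
  k∉ k∈ = m≢1+m+n k (proj₁ (proj₂ (∈-components⁻ (suc k) F k∈)))

at⇒∈-components : ∀ F {j T} → at F j ≡ just T → (j , T) ∈ components 2 F
at⇒∈-components F {suc (suc i)} eq = ∈-components⁺ 2 F i (trans (sym (at-component F i)) eq)

∈-components⇒at : ∀ F {j T} → (j , T) ∈ components 2 F → at F j ≡ just T
∈-components⇒at F j∈ with ∈-components⁻ 2 F j∈
... | i , refl , eq = trans (at-component F i) eq

-- (variable, track, type)
Entry : Set
Entry = ℕ × ℕ × Ty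

eraseCtx : List Entry → Context
eraseCtx = map (map₂ (erase ∘ proj₂))

_∈Ctx_ : Entry → Ctx → Set
(x , j , T) ∈Ctx C = C x j ≡ just T

record Represents (Γ : List Entry) (C : Ctx) : Set where
  field
    complete : ∀ {e} → e ∈Ctx C → e ∈ Γ
    sound    : ∀ {e} → e ∈ Γ → e ∈Ctx C
    unique   : Unique Γ

Represents-abs : ∀ {Γ C F} → Represents Γ C → (∀ k → at F k ≡ C 0 k) →
                 typesOf 0 (eraseCtx Γ) ↭ eraseSeq F
Represents-abs {Γ} {C} {F} rep F≗C = begin
  typesOf 0 (eraseCtx Γ)                     ≡⟨ typesOf-map₂ (erase ∘ proj₂) 0 Γ ⟩
  map (erase ∘ proj₂) (typesOf 0 Γ)          ↭⟨ ↭ₚ.map⁺ _ (∼bag⇒↭ (unique∧set⇒bag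
                                                  (typesOf0-unique unique) (components-unique 2 F)
                                                  (mk⇔ ⊆components components⊆))) ⟩
  map (erase ∘ proj₂) (components 2 F)       ≡⟨ eraseSeq-components 2 F ⟨
  eraseSeq F ∎
  where
  open Represents rep
  open PermutationReasoning
  ⊆components : ∀ {jT} → jT ∈ typesOf 0 Γ → jT ∈ components 2 F
  ⊆components {j , T} jT∈ = at⇒∈-components F (trans (F≗C j) (sound (∈-typesOf0⁻ jT∈)))
  components⊆ : ∀ {jT} → jT ∈ components 2 F → jT ∈ typesOf 0 Γ
  components⊆ {j , T} jT∈ = ∈-typesOf0⁺ (complete (trans (sym (F≗C j)) (∈-components⇒at F jT∈)))

Represents-single : ∀ {C x k T} → C x k ≡ just T → (∀ y j → Defined (C y j) → y ≡ x × j ≡ k) →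
                    Represents ((x , k , T) ∷ []) C
Represents-single {C} {x} {k} {T} C∋T single = record
  { complete = complete
  ; sound    = λ { (here refl) → C∋T }
  ; unique   = Unique-∷ (λ ()) []
  }
  where
  complete : ∀ {e} → e ∈Ctx C → e ∈ (x , k , T) ∷ []
  complete {y , j , S} C∋S with single y j (S , C∋S)
  ... | refl , refl with trans (sym C∋S) C∋T
  ... | refl = here refl

Represents-removeVar0 : ∀ {Γ C E} → Represents Γ C → (∀ y j → E y j ≡ C (suc y) j) →
                        Represents (removeVar 0 Γ) E
Represents-removeVar0 rep E≗C = record
  { complete = λ {(y , j , T)} E∋T → ∈-removeVar0⁺ (complete (trans (sym (E≗C y j)) E∋T))
  ; sound    = λ {(y , j , T)} e∈ → trans (E≗C y j) (sound (∈-removeVar0⁻ e∈))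
  ; unique   = removeVar0-unique unique
  }
  where open Represents rep

PairwiseDisjoint : (ℕ → Set) → (ℕ → Ctx) → Set
PairwiseDisjoint K D = ∀ {k k′} → K k → K k′ → ∀ {x j} → Defined (D k x j) → Defined (D k′ x j) → k ≡ k′

PairwiseDisjoint-suc : ∀ {K D} → PairwiseDisjoint K D → PairwiseDisjoint (K ∘ suc) (D ∘ suc)
PairwiseDisjoint-suc disjoint Kk Kk′ d d′ = suc-injective (disjoint Kk Kk′ d d′)

DisjUnion⇒PairwiseDisjoint : ∀ {E C F D} → DisjUnion E C (Defined ∘ at F) D →
                             PairwiseDisjoint (Defined ∘ component F) (D ∘ suc ∘ suc)
DisjUnion⇒PairwiseDisjoint {F = F} union (S , eq) (S′ , eq′) d d′ =
  suc-injective (suc-injective (DisjUnion.disjDD union _ _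
    (S , trans (at-component F _) eq) (S′ , trans (at-component F _) eq′) _ _ d d′))

record RepresentsFamily (Γ : List Entry) (K : ℕ → Set) (D : ℕ → Ctx) : Set where
  field
    complete : ∀ {k e} → K k → e ∈Ctx D k → e ∈ Γ
    sound    : ∀ {e} → e ∈ Γ → Σ ℕ λ k → K k × e ∈Ctx D k
    unique   : Unique Γ

module _ {K : ℕ → Set} {D : ℕ → Ctx} where

  RepresentsFamily-skip : ∀ {Γ} → ¬ K 0 → RepresentsFamily Γ (K ∘ suc) (D ∘ suc) → RepresentsFamily Γ K D
  RepresentsFamily-skip ¬K0 fam = record
    { complete = λ { {zero} K0 _ → contradiction K0 ¬K0 ; {suc k} Kk e∈ → complete Kk e∈ }
    ; sound    = λ e∈ → let (k , Kk , e∈D) = sound e∈ in suc k , Kk , e∈D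
    ; unique   = unique
    }
    where open RepresentsFamily fam

  RepresentsFamily-cons : ∀ {Γ₀ Γ} → K 0 → Represents Γ₀ (D 0) → RepresentsFamily Γ (K ∘ suc) (D ∘ suc) →
                          PairwiseDisjoint K D → RepresentsFamily (Γ₀ ++ Γ) K D
  RepresentsFamily-cons {Γ₀} K0 rep fam disjoint = record
    { complete = λ { {zero} _ e∈ → ∈-++⁺ˡ (R.complete e∈) ; {suc k} Kk e∈ → ∈-++⁺ʳ Γ₀ (F.complete Kk e∈) }
    ; sound    = sound
    ; unique   = Unique.++⁺ R.unique F.unique apart
    }
    where
    module R = Represents rep
    module F = RepresentsFamily fam
    sound : ∀ {e} → e ∈ Γ₀ ++ _ → Σ ℕ λ k → K k × e ∈Ctx D k
    sound e∈ with ∈-++⁻ Γ₀ e∈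
    ... | inj₁ e∈Γ₀ = 0 , K0 , R.sound e∈Γ₀
    ... | inj₂ e∈Γ  = let (k , Kk , e∈D) = F.sound e∈Γ in suc k , Kk , e∈D
    apart : ∀ {e} → ¬ (e ∈ Γ₀ × e ∈ _)
    apart {x , j , T} (e∈Γ₀ , e∈Γ) =
      let (k , Kk , e∈D) = F.sound e∈Γ in 0≢1+n (disjoint K0 Kk (T , R.sound e∈Γ₀) (T , e∈D))

Represents-union : ∀ {Γ₁ Γ₂ E C K D} → Represents Γ₁ C → RepresentsFamily Γ₂ K D → DisjUnion E C K D →
                   Represents (Γ₁ ++ Γ₂) E
Represents-union {Γ₁} {Γ₂} {E} rep fam union = record
  { complete = complete
  ; sound    = sound
  ; unique   = Unique.++⁺ R.unique F.unique apart
  }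
  where
  open DisjUnion union
  module R = Represents rep
  module F = RepresentsFamily fam
  complete : ∀ {e} → e ∈Ctx E → e ∈ Γ₁ ++ Γ₂
  complete {x , j , T} E∋T with toSrc x j T E∋T
  ... | inj₁ C∋T            = ∈-++⁺ˡ (R.complete C∋T)
  ... | inj₂ (k , Kk , D∋T) = ∈-++⁺ʳ Γ₁ (F.complete Kk D∋T)
  sound : ∀ {e} → e ∈ Γ₁ ++ Γ₂ → e ∈Ctx E
  sound {x , j , T} e∈ with ∈-++⁻ Γ₁ e∈
  ... | inj₁ e∈Γ₁ = fromC x j T (R.sound e∈Γ₁)
  ... | inj₂ e∈Γ₂ = let (k , Kk , D∋T) = F.sound e∈Γ₂ in fromD k Kk x j T D∋T
  apart : ∀ {e} → ¬ (e ∈ Γ₁ × e ∈ Γ₂)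
  apart {x , j , T} (e∈Γ₁ , e∈Γ₂) with F.sound e∈Γ₂
  ... | k , Kk , D∋T with () ← trans (sym D∋T) (disjCD k Kk x j (T , R.sound e∈Γ₁))

RepresentsFamily-tracks : ∀ {Γ F D} → RepresentsFamily Γ (Defined ∘ component F) (D ∘ suc ∘ suc) →
                          RepresentsFamily Γ (Defined ∘ at F) D
RepresentsFamily-tracks {F = F} fam = record
  { complete = λ { {suc (suc i)} (S , eq) e∈ → complete (S , trans (sym (at-component F i)) eq) e∈ }
  ; sound    = λ e∈ → let (i , (S , eq) , e∈D) = sound e∈ in
                      suc (suc i) , (S , trans (at-component F i) eq) , e∈D
  ; unique   = unique
  }
  where open RepresentsFamily fam

record Translation (C : Ctx) (u : Tree) (T : Ty) : Set where
  constructor translation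
  field
    {entries}  : List Entry
    {size}     : ℕ
    represents : Represents entries C
    derivation : Der (eraseCtx entries) u (erase T) size

record ArgsTranslation (F : List (Maybe Ty)) (D : ℕ → Ctx) (u : Tree) : Set where
  constructor argsTranslation
  field
    {entries}   : List (List Entry)
    {size}      : ℕ
    represents  : RepresentsFamily (concat entries) (Defined ∘ component F) D
    derivations : Ders (map eraseCtx entries) u (eraseSeq F) size

translateArgs : ∀ F {D u} → PairwiseDisjoint (Defined ∘ component F) D →
                (∀ i {S} → component F i ≡ just S → Translation (D i) u S) → ArgsTranslation F D u
translateArgs [] _ _ = argsTranslation (record { complete = λ () ; sound = λ () ; unique = [] }) []
translateArgs (nothing ∷ F) disjoint tr with translateArgs F (PairwiseDisjoint-suc disjoint) (tr ∘ suc)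
... | argsTranslation fam Ds = argsTranslation (RepresentsFamily-skip (λ ()) fam) Ds
translateArgs (just S ∷ F) disjoint tr
  with tr 0 refl | translateArgs F (PairwiseDisjoint-suc disjoint) (tr ∘ suc)
... | translation rep D | argsTranslation fam Ds =
  argsTranslation (RepresentsFamily-cons (S , refl) rep fam disjoint) (D ∷ Ds)

eraseCtx-++ : ∀ Γ Γs → eraseCtx (Γ ++ concat Γs) ≡ eraseCtx Γ ++ concat (map eraseCtx Γs)
eraseCtx-++ Γ Γs = trans (map-++ _ Γ (concat Γs)) (cong (eraseCtx Γ ++_) (sym (concat-map Γs)))

translate : ∀ {C t T} → Deriv C t T → Translation C t T
translate (ax root _ C∋T single) = translation (Represents-single C∋T single) (ax root)
translate (abs root D F≗C E≗C) with translate D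
... | translation {Γ} rep D′ =
  translation (Represents-removeVar0 rep E≗C)
    (subst (λ Δ → Der Δ _ _ _) (removeVar-map₂ (erase ∘ proj₂) 0 Γ) (abs root D′ (Represents-abs rep F≗C)))
translate (app {F = F} D root Dfun Dargs union)
  with translate Dfun
     | translateArgs F (DisjUnion⇒PairwiseDisjoint union)
         (λ i eq → translate (Dargs (suc (suc i)) _ (trans (at-component F i) eq)))
... | translation {Γ} rep D′ | argsTranslation {Γs} fam Ds =
  translation (Represents-union rep (RepresentsFamily-tracks fam) union)
    (subst (λ Δ → Der Δ _ _ _) (sym (eraseCtx-++ Γ Γs)) (app root D′ Ds))

lemma6 : (t : Term) → Λ001 (tree t) → (C : Ctx) (T : Ty) → Deriv C (tree t) T →
    HeadNormalizable t
lemma6 t _ C T D = typable⇒headNormalizable _ t (_ , _ , Translation.derivation (translate D))
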